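{- For any set of box rules $\mathcal R$, weakening and contraction are depth-preserving admissible in $\mathsf{G3p}+\mathcal R$: for all sequents $S,S'$ and all $d$, (a) if $\vdash_d S$ then $\vdash_d S'\cdot S$; (b) if $\vdash_d S'\cdot S'\cdot S$ then $\vdash_d S'\cdot S$.
   Context: Formulas are built from $\top,\bot$ and atoms using $\wedge,\vee,\neg,\to,\Box$. A sequent $\Gamma\Rightarrow\Delta$ consists of two finite multisets of formulas; for a sequent $S$, $S^a$ and $S^s$ are its antecedent and succedent, $S_1\cdot S_2=(S_1^a\cup S_2^a\Rightarrow S_1^s\cup S_2^s)$ (multiset unions), and $\Box S=(\Box S^a\Rightarrow\Box S^s)$ where $\Box\Gamma=\{\Box\varphi:\varphi\in\Gamma\}$. A rule is a scheme $S_1\ \dots\ S_n/S_0$ of sequents ($n\ge 0$). $\mathsf{G3p}$ has the rules: axioms $\Gamma,p\Rightarrow p,\Delta$ ($p$ atom) and $\Gamma,\bot\Rightarrow\Delta$; $L\wedge$: $\Gamma,\varphi,\psi\Rightarrow\Delta\,/\,\Gamma,\varphi\wedge\psi\Rightarrow\Delta$; $R\wedge$: $\Gamma\Rightarrow\varphi,\Delta$ and $\Gamma\Rightarrow\psi,\Delta\,/\,\Gamma\Rightarrow\varphi\wedge\psi,\Delta$; $L\vee$: $\Gamma,\varphi\Rightarrow\Delta$ and $\Gamma,\psi\Rightarrow\Delta\,/\,\Gamma,\varphi\vee\psi\Rightarrow\Delta$; $R\vee$: $\Gamma\Rightarrow\varphi,\psi,\Delta\,/\,\Gamma\Rightarrow\varphi\vee\psi,\Delta$;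 $L\!\to$: $\Gamma\Rightarrow\varphi,\Delta$ and $\Gamma,\psi\Rightarrow\Delta\,/\,\Gamma,\varphi\to\psi\Rightarrow\Delta$; $R\!\to$: $\Gamma,\varphi\Rightarrow\psi,\Delta\,/\,\Gamma\Rightarrow\varphi\to\psi,\Delta$. A rule $R$ is a box rule if: (i) its conclusion has the form $\Box S\cdot(\Gamma\Rightarrow\Sigma)$ for some sequent $S$ and multiset variables $\Gamma,\Sigma$ not occurring in $S$ nor in the premisses; (ii) all premisses consist of subformulas of formulas in $S$; (iii) whenever $S_1\ \dots\ S_n/(\Gamma\Rightarrow\Sigma)\cdot\Box(S_0\cdot S_0'\cdot S_0')$ is an instance of $R$, there are sequents $S_i',S_i''$ with $S_i=S_i'\cdot S_i''\cdot S_i''$ such that $S_1'\cdot S_1''\ \dots\ S_n'\cdot S_n''/(\Gamma\Rightarrow\Sigma)\cdot\Box(S_0\cdot S_0')$ is also an instance of $R$. A derivation is a finite tree labelled by sequents in which each inner node together with its children is an instance of a rule of the calculus and each leaf is an instance of an axiom (premiss-free rule); its depth is the length of its longest branch. $\vdash_d S$ means $S$ has a derivation in $\mathsf{G3p}+\mathcal R$ of depth at most $d$. -}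

module Defs where

open import Data.Nat using (ℕ; suc)
open import Data.List using (List; []; _∷_; _++_; map)
open import Data.List.Relation.Unary.All using (All)
open import Data.List.Relation.Unary.Any using (Any)
open import Data.List.Relation.Binary.Pointwise using (Pointwise)
open import Data.List.Relation.Binary.Permutation.Propositional using (_↭_)
open import Data.List.Membership.Propositional using (_∈_)
open import Data.Product using (Σ; _×_; _,_; proj₁; proj₂)
open import Data.Sum using (_⊎_)

data Fml : Set where
  ⊤' ⊥' : Fml
  atom  : ℕ → Fml
  _∧'_ _∨'_ _⇒'_ : Fml → Fml → Fml
  ¬' □' : Fml → Fml

data Sub : Fml → Fml → Set where
  refl  : ∀ {φ} → Sub φ φ
  ∧l : ∀ {φ a b} → Sub φ a → Sub φ (a ∧' b)
  ∧r : ∀ {φ a b} → Sub φ b → Sub φ (a ∧' b)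
  ∨l : ∀ {φ a b} → Sub φ a → Sub φ (a ∨' b)
  ∨r : ∀ {φ a b} → Sub φ b → Sub φ (a ∨' b)
  ⇒l : ∀ {φ a b} → Sub φ a → Sub φ (a ⇒' b)
  ⇒r : ∀ {φ a b} → Sub φ b → Sub φ (a ⇒' b)
  ¬s : ∀ {φ a} → Sub φ a → Sub φ (¬' a)
  □s : ∀ {φ a} → Sub φ a → Sub φ (□' a)

-- Multisets are lists considered up to permutation (_↭_).
-- A sequent is a pair (antecedent , succedent).
Sequent : Set
Sequent = List Fml × List Fml

ant suc' : Sequent → List Fml
ant = proj₁
suc' = proj₂

_≈_ : Sequent → Sequent → Set
S ≈ T = (proj₁ S ↭ proj₁ T) × (proj₂ S ↭ proj₂ T)

infixl 6 _·_
_·_ : Sequent → Sequent → Sequent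
(a , s) · (b , t) = (a ++ b , s ++ t)

□ₛ : Sequent → Sequent
□ₛ (a , s) = (map □' a , map □' s)

-- Instances of the rules of G3p (given on concrete lists; the conclusion
-- of an actual rule application is taken up to multiset equality, see G3pInst).
data G3p : List Sequent → Sequent → Set where
  ax  : ∀ Γ Δ p → G3p [] (atom p ∷ Γ , atom p ∷ Δ)
  ax⊥ : ∀ Γ Δ → G3p [] (⊥' ∷ Γ , Δ)
  L∧  : ∀ Γ Δ φ ψ → G3p ((φ ∷ ψ ∷ Γ , Δ) ∷ []) ((φ ∧' ψ) ∷ Γ , Δ)
  R∧  : ∀ Γ Δ φ ψ → G3p ((Γ , φ ∷ Δ) ∷ (Γ , ψ ∷ Δ) ∷ []) (Γ , (φ ∧' ψ) ∷ Δ)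
  L∨  : ∀ Γ Δ φ ψ → G3p ((φ ∷ Γ , Δ) ∷ (ψ ∷ Γ , Δ) ∷ []) ((φ ∨' ψ) ∷ Γ , Δ)
  R∨  : ∀ Γ Δ φ ψ → G3p ((Γ , φ ∷ ψ ∷ Δ) ∷ []) (Γ , (φ ∨' ψ) ∷ Δ)
  L→  : ∀ Γ Δ φ ψ → G3p ((Γ , φ ∷ Δ) ∷ (ψ ∷ Γ , Δ) ∷ []) ((φ ⇒' ψ) ∷ Γ , Δ)
  R→  : ∀ Γ Δ φ ψ → G3p ((φ ∷ Γ , ψ ∷ Δ) ∷ []) (Γ , (φ ⇒' ψ) ∷ Δ)

G3pInst : List Sequent → Sequent → Set
G3pInst ps T = Σ Sequent λ T₀ → G3p ps T₀ × T ≈ T₀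

-- A box rule is presented by its "core" relation: Core ps S holds when
-- ps / S is an instantiation of the premisses and of the sequent S in
-- the conclusion □S·(Γ⇒Σ).  By condition (i) (Γ,Σ fresh), the instances
-- of the rule are exactly ps / □S·C for Core ps S and arbitrary C.
BoxInst : (List Sequent → Sequent → Set) → List Sequent → Sequent → Set
BoxInst Core ps T = Σ Sequent λ S → Σ Sequent λ C → Core ps S × T ≈ (C · □ₛ S)

SubSeq : Sequent → Sequent → Set
SubSeq P S = All (λ φ → Any (Sub φ) (ant S ++ suc' S)) (ant P ++ suc' P)

record BoxRule : Set₁ where
  field
    Core : List Sequent → Sequent → Set
    subf : ∀ {ps S} → Core ps S → All (λ P → SubSeq P S) ps
    -- (iii) closure under contraction in the boxed part
    contr : ∀ ps C S₀ S₀' → BoxInst Core ps (C · □ₛ (S₀ · S₀' · S₀')) →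
            Σ (List (Sequent × Sequent)) λ qs →
              Pointwise (λ P q → P ≈ (proj₁ q · proj₂ q · proj₂ q)) ps qs ×
              BoxInst Core (map (λ q → proj₁ q · proj₂ q) qs) (C · □ₛ (S₀ · S₀'))
  Inst : List Sequent → Sequent → Set
  Inst = BoxInst Core

CalcInst : {I : Set} → (I → BoxRule) → List Sequent → Sequent → Set
CalcInst {I} R ps T = G3pInst ps T ⊎ Σ I λ i → BoxRule.Inst (R i) ps T

-- ⊢[ R ] d , T : T has a derivation in G3p + R of depth at most d
-- (a leaf has depth 0; an inner node has depth 1 + max depth of children)
data ⊢[_]_,_ {I : Set} (R : I → BoxRule) : ℕ → Sequent → Set where
  leaf : ∀ {d T} → CalcInst R [] T → ⊢[ R ] d , T
  node : ∀ {d ps T} → CalcInst R ps T → All (λ P → ⊢[ R ] d , P) ps → ⊢[ R ] suc d , T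

module Submission where

-- Weakening is a routine induction: every G3p rule has an arbitrary context, and a box rule
-- absorbs the new formulas into its context Γ ⇒ Σ.  Contraction of a formula φ goes by
-- induction on the depth, using depth-preserving invertibility of the logical rules.  If φ is
-- principal in the last logical rule, invert that rule in its premisses, contract the side
-- formulas by induction and reapply the rule; otherwise contract in the premisses.  If both
-- copies of φ lie in the boxed part □S of a box rule, condition (iii) gives an instance with
-- one copy removed whose premisses are contractions of the old ones, again by induction.
-- Contracting a whole sequent S' is contracting its formulas one at a time.

open import Defs hiding (_≈_)
open import Algebra using (CommutativeMonoid)
open import Algebra.Construct.DirectProduct using (commutativeMonoid)
import Algebra.Properties.CommutativeSemigroup as CommutativeSemigroupProperties
import Algebra.Solver.CommutativeMonoid as CommutativeMonoidSolver
open import Data.Nat using (ℕ; suc)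
open import Data.Product using (∃-syntax; _×_; _,_; proj₁; proj₂; swap)
open import Data.Sum using (_⊎_; inj₁; inj₂)
open import Data.Empty using (⊥-elim)
open import Data.List using (List; []; _∷_; _++_; map; [_])
open import Data.List.Relation.Unary.All as All using (All; []; _∷_)
import Data.List.Relation.Unary.All.Properties as Allₚ
open import Data.List.Relation.Unary.Any using (here; there)
open import Data.List.Relation.Binary.Pointwise using (Pointwise; []; _∷_)
open import Data.List.Relation.Binary.Permutation.Propositional
  using (_↭_; prep; ↭-refl; ↭-sym; ↭-trans) renaming (swap to ↭-swap)
open import Data.List.Relation.Binary.Permutation.Propositional.Properties
  using (∈-resp-↭; ++⁺ˡ; ++⁺ʳ; shift; drop-∷; map⁺; ++-commutativeMonoid)
open import Data.List.Relation.Binary.Subset.Propositional using (_⊆_)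
open import Data.List.Relation.Binary.Subset.Propositional.Properties
  using (⊆-reflexive-↭; xs⊆ys++xs)
open import Data.List.Membership.Propositional using (_∈_)
open import Data.List.Membership.Propositional.Properties
  using (∈-∃++; ∈-++⁻; ∈-++⁺ˡ; ∈-map⁻)
open import Relation.Binary.PropositionalEquality using (_≡_; _≢_; refl; cong)

module _ {a} {A : Set a} where

  ∈⇒↭∷ : ∀ {x : A} {xs} → x ∈ xs → ∃[ ys ] xs ↭ x ∷ ys
  ∈⇒↭∷ x∈xs with ys , zs , refl ← ∈-∃++ x∈xs = ys ++ zs , shift _ ys zs

  ∈-∷⁻ : ∀ {x y : A} {xs} → x ∈ y ∷ xs → x ≢ y → x ∈ xs
  ∈-∷⁻ (here x≡y) x≢y with () ← x≢y x≡y
  ∈-∷⁻ (there x∈xs) _ = x∈xs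

  xs++xs++ys⊆xs++ys : ∀ (xs : List A) {ys} → xs ++ xs ++ ys ⊆ xs ++ ys
  xs++xs++ys⊆xs++ys xs x∈ with ∈-++⁻ xs x∈
  ... | inj₁ x∈xs = ∈-++⁺ˡ x∈xs
  ... | inj₂ x∈xs++ys = x∈xs++ys

  ∷↭∷⁻ : ∀ {x y : A} {xs ys} → x ∷ xs ↭ y ∷ ys →
         (x ≡ y × xs ↭ ys) ⊎ ∃[ zs ] (xs ↭ y ∷ zs × ys ↭ x ∷ zs)
  ∷↭∷⁻ {x} {y} p with ∈-resp-↭ (↭-sym p) (here refl)
  ... | here refl = inj₁ (refl , drop-∷ p)
  ... | there y∈xs with zs , q ← ∈⇒↭∷ y∈xs =
    inj₂ (zs , q , drop-∷ (↭-trans (↭-sym p) (↭-trans (prep x q) (↭-swap x y ↭-refl))))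

  ∷↭++⁻ : ∀ {x : A} {xs} ys {zs} → x ∷ xs ↭ ys ++ zs →
          (∃[ ys' ] xs ↭ ys' ++ zs) ⊎ (∃[ zs' ] zs ↭ x ∷ zs' × xs ↭ ys ++ zs')
  ∷↭++⁻ ys {zs} p with ∈-++⁻ ys (∈-resp-↭ p (here refl))
  ... | inj₁ x∈ys with ys' , q ← ∈⇒↭∷ x∈ys =
    inj₁ (ys' , drop-∷ (↭-trans p (++⁺ʳ zs q)))
  ... | inj₂ x∈zs with zs' , q ← ∈⇒↭∷ x∈zs =
    inj₂ (zs' , q , drop-∷ (↭-trans p (↭-trans (++⁺ˡ ys q) (shift _ ys zs'))))

module _ {a b} {A : Set a} {B : Set b} (f : A → B) where

  map↭∷⁻ : ∀ {xs y ys} → map f xs ↭ y ∷ ys →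
           ∃[ x ] ∃[ xs' ] (y ≡ f x × xs ↭ x ∷ xs' × ys ↭ map f xs')
  map↭∷⁻ p with x , x∈xs , refl ← ∈-map⁻ f (∈-resp-↭ (↭-sym p) (here refl))
    with xs' , q ← ∈⇒↭∷ x∈xs = x , xs' , refl , q , drop-∷ (↭-trans (↭-sym p) (map⁺ f q))

-- Its _≈_ and _∙_ are definitionally Defs' _≈_ and _·_; its _≈_ replaces the one of Defs,
-- which has no fixity declaration.
sequentMonoid : CommutativeMonoid _ _
sequentMonoid = commutativeMonoid (++-commutativeMonoid {A = Fml}) (++-commutativeMonoid {A = Fml})

open CommutativeMonoid sequentMonoid
  using (_≈_; assoc; comm; ∙-congˡ; setoid)
  renaming (refl to ≈-refl; sym to ≈-sym; trans to ≈-trans)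
open CommutativeSemigroupProperties (CommutativeMonoid.commutativeSemigroup sequentMonoid)
  using (x∙yz≈y∙xz)
open CommutativeMonoidSolver sequentMonoid using (solve; _⊕_; _⊜_)
open import Relation.Binary.Reasoning.Setoid setoid

data Side : Set where
  left right : Side

⟨_∣_⟩ : Side → Fml → Sequent
⟨ left ∣ φ ⟩ = [ φ ] , []
⟨ right ∣ φ ⟩ = [] , [ φ ]

private variable
  s : Side
  φ χ ψ : Fml
  C S T T' U W : Sequent
  ps es : List Sequent
  d : ℕ

□ₛ-cong : S ≈ T → □ₛ S ≈ □ₛ T
□ₛ-cong (p , q) = map⁺ □' p , map⁺ □' q

□ₛ-⟨⟩· : ∀ s ψ S → □ₛ (⟨ s ∣ ψ ⟩ · S) ≡ ⟨ s ∣ □' ψ ⟩ · □ₛ S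
□ₛ-⟨⟩· left ψ S = refl
□ₛ-⟨⟩· right ψ S = refl

⟨□⟩·-absorb : ∀ s ψ C S → ⟨ s ∣ □' ψ ⟩ · (C · □ₛ S) ≈ C · □ₛ (⟨ s ∣ ψ ⟩ · S)
⟨□⟩·-absorb s ψ C S = begin
  ⟨ s ∣ □' ψ ⟩ · (C · □ₛ S)  ≈⟨ x∙yz≈y∙xz ⟨ s ∣ □' ψ ⟩ C (□ₛ S) ⟩
  C · (⟨ s ∣ □' ψ ⟩ · □ₛ S)  ≡⟨ cong (C ·_) (□ₛ-⟨⟩· s ψ S) ⟨
  C · □ₛ (⟨ s ∣ ψ ⟩ · S)     ∎

data Insertions (s : Side) (φ : Fml) (U : Sequent) : Side → Fml → Sequent → Set where
  same     : ∀ {U'} → U ≈ U' → Insertions s φ U s φ U'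
  distinct : ∀ {s' χ U'} W → U' ≈ ⟨ s ∣ φ ⟩ · W → U ≈ ⟨ s' ∣ χ ⟩ · W →
             Insertions s φ U s' χ U'

compareInsertions : ∀ s s' {φ χ U U'} → ⟨ s ∣ φ ⟩ · U ≈ ⟨ s' ∣ χ ⟩ · U' →
                    Insertions s φ U s' χ U'
compareInsertions left left {U = Γ , Δ} (a , b) with ∷↭∷⁻ a
... | inj₁ (refl , p) = same (p , b)
... | inj₂ (K , p , q) = distinct (K , Δ) (q , ↭-sym b) (p , ↭-refl)
compareInsertions left right {U = Γ , Δ} {_ , Δ'} (a , b) =
  distinct (Γ , Δ') (↭-sym a , ↭-refl) (↭-refl , b)
compareInsertions right left {U = Γ , Δ} {Γ' , _} (a , b) =
  distinct (Γ' , Δ) (↭-refl , ↭-sym b) (a , ↭-refl)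
compareInsertions right right {U = Γ , Δ} (a , b) with ∷↭∷⁻ b
... | inj₁ (refl , p) = same (a , p)
... | inj₂ (K , p , q) = distinct (Γ , K) (↭-sym a , q) (↭-refl , p)

data BoxSplit (s : Side) (U C S : Sequent) : Fml → Set where
  inContext : ∀ {φ} C' → U ≈ C' · □ₛ S → BoxSplit s U C S φ
  inBoxed   : ∀ {ψ} S' → S ≈ ⟨ s ∣ ψ ⟩ · S' → U ≈ C · □ₛ S' → BoxSplit s U C S (□' ψ)

-- swap commutes definitionally with _·_ and □ₛ, and exchanges ⟨ left ∣ φ ⟩ and ⟨ right ∣ φ ⟩.
boxSplit : ∀ s → ⟨ s ∣ φ ⟩ · U ≈ C · □ₛ S → BoxSplit s U C S φ
boxSplit {C = Ca , Cs} {S = Sa , Ss} left (a , b) with ∷↭++⁻ Ca a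
... | inj₁ (Ca' , p) = inContext (Ca' , Cs) (p , b)
... | inj₂ (zs , q , p) with ψ , Sa' , refl , r , t ← map↭∷⁻ □' q =
  inBoxed (Sa' , Ss) (r , ↭-refl) (↭-trans p (++⁺ˡ Ca t) , b)
boxSplit {U = U} {C} {S} right e with boxSplit {U = swap U} {swap C} {swap S} left (swap e)
... | inContext C' U≈ = inContext (swap C') (swap U≈)
... | inBoxed S' S≈ U≈ = inBoxed (swap S') (swap S≈) (swap U≈)

data ContractionBoxSplit (s : Side) (φ : Fml) (U C S : Sequent) : Set where
  inContext : ∀ C' → ⟨ s ∣ φ ⟩ · U ≈ C' · □ₛ S → ContractionBoxSplit s φ U C S
  inBoxed   : ∀ S₀ S₀' → S ≈ S₀ · S₀' · S₀' → ⟨ s ∣ φ ⟩ · U ≈ C · □ₛ (S₀ · S₀') →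
              ContractionBoxSplit s φ U C S

contractionBoxSplit : ∀ s → ⟨ s ∣ φ ⟩ · (⟨ s ∣ φ ⟩ · U) ≈ C · □ₛ S →
                      ContractionBoxSplit s φ U C S
contractionBoxSplit {U = U} {C} {S} s e with boxSplit s e
... | inContext C' φU≈ = inContext C' φU≈
... | inBoxed {ψ} S' S≈ φU≈ with boxSplit s φU≈
...   | inContext C' U≈ = inContext C' (begin
  ⟨ s ∣ □' ψ ⟩ · U           ≈⟨ ∙-congˡ U≈ ⟩
  ⟨ s ∣ □' ψ ⟩ · (C' · □ₛ S') ≈⟨ ⟨□⟩·-absorb s ψ C' S' ⟩
  C' · □ₛ (⟨ s ∣ ψ ⟩ · S')    ≈⟨ ∙-congˡ (□ₛ-cong (≈-sym S≈)) ⟩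
  C' · □ₛ S                  ∎)
...   | inBoxed S₀ S'≈ U≈ = inBoxed S₀ ⟨ s ∣ ψ ⟩
  (begin
    S                              ≈⟨ S≈ ⟩
    ⟨ s ∣ ψ ⟩ · S'                 ≈⟨ ∙-congˡ S'≈ ⟩
    ⟨ s ∣ ψ ⟩ · (⟨ s ∣ ψ ⟩ · S₀)   ≈⟨ solve 2 (λ P S₀ → P ⊕ (P ⊕ S₀) ⊜ (S₀ ⊕ P) ⊕ P)
                                             ≈-refl ⟨ s ∣ ψ ⟩ S₀ ⟩
    S₀ · ⟨ s ∣ ψ ⟩ · ⟨ s ∣ ψ ⟩     ∎)
  (begin
    ⟨ s ∣ □' ψ ⟩ · U               ≈⟨ ∙-congˡ U≈ ⟩
    ⟨ s ∣ □' ψ ⟩ · (C · □ₛ S₀)     ≈⟨ ⟨□⟩·-absorb s ψ C S₀ ⟩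
    C · □ₛ (⟨ s ∣ ψ ⟩ · S₀)        ≈⟨ ∙-congˡ (□ₛ-cong (comm ⟨ s ∣ ψ ⟩ S₀)) ⟩
    C · □ₛ (S₀ · ⟨ s ∣ ψ ⟩)        ∎)

data Axiom (T : Sequent) : Set where
  init : ∀ p → atom p ∈ ant T → atom p ∈ suc' T → Axiom T
  ⊥L   : ⊥' ∈ ant T → Axiom T

infix 4 _⊆ₛ_
_⊆ₛ_ : Sequent → Sequent → Set
S ⊆ₛ T = ant S ⊆ ant T × suc' S ⊆ suc' T

Axiom-mono : S ⊆ₛ T → Axiom S → Axiom T
Axiom-mono (a , s) (init p pa ps) = init p (a pa) (s ps)
Axiom-mono (a , s) (⊥L ⊥a) = ⊥L (a ⊥a)

≈⇒⊆ₛ : S ≈ T → S ⊆ₛ T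
≈⇒⊆ₛ (p , q) = ⊆-reflexive-↭ p , ⊆-reflexive-↭ q

T⊆ₛS·T : ∀ S T → T ⊆ₛ S · T
T⊆ₛS·T (Γ , Δ) (Γ' , Δ') = xs⊆ys++xs Γ' Γ , xs⊆ys++xs Δ' Δ

S·S·T⊆ₛS·T : ∀ S T → S · (S · T) ⊆ₛ S · T
S·S·T⊆ₛS·T (Γ , Δ) _ = xs++xs++ys⊆xs++ys Γ , xs++xs++ys⊆xs++ys Δ

Axiom-⟨⟩⁻ : ∀ s → (∀ p → atom p ≢ χ) → ⊥' ≢ χ → Axiom (⟨ s ∣ χ ⟩ · U) → Axiom U
Axiom-⟨⟩⁻ left atom≢χ _ (init p pa ps) = init p (∈-∷⁻ pa (atom≢χ p)) ps
Axiom-⟨⟩⁻ left _ ⊥≢χ (⊥L ⊥a) = ⊥L (∈-∷⁻ ⊥a ⊥≢χ)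
Axiom-⟨⟩⁻ right atom≢χ _ (init p pa ps) = init p pa (∈-∷⁻ ps (atom≢χ p))
Axiom-⟨⟩⁻ right _ _ (⊥L ⊥a) = ⊥L ⊥a

-- The logical rules of G3p, by side and principal formula; a premiss e
-- stands for the sequent e · U, where U is the context of the conclusion.
data Rule : Side → Fml → List Sequent → Set where
  L∧ : ∀ φ ψ → Rule left (φ ∧' ψ) ((φ ∷ ψ ∷ [] , []) ∷ [])
  R∧ : ∀ φ ψ → Rule right (φ ∧' ψ) (([] , [ φ ]) ∷ ([] , [ ψ ]) ∷ [])
  L∨ : ∀ φ ψ → Rule left (φ ∨' ψ) (([ φ ] , []) ∷ ([ ψ ] , []) ∷ [])
  R∨ : ∀ φ ψ → Rule right (φ ∨' ψ) (([] , φ ∷ ψ ∷ []) ∷ [])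
  L→ : ∀ φ ψ → Rule left (φ ⇒' ψ) (([] , [ φ ]) ∷ ([ ψ ] , []) ∷ [])
  R→ : ∀ φ ψ → Rule right (φ ⇒' ψ) (([ φ ] , [ ψ ]) ∷ [])

atom≢principal : ∀ {p} → Rule s χ es → atom p ≢ χ
atom≢principal () refl

⊥≢principal : Rule s χ es → ⊥' ≢ χ
⊥≢principal () refl

principal≢□ : Rule s χ es → χ ≢ □' ψ
principal≢□ () refl

Rule-unique : ∀ {es'} → Rule s χ es → Rule s χ es' → es ≡ es'
Rule-unique (L∧ _ _) (L∧ _ _) = refl
Rule-unique (R∧ _ _) (R∧ _ _) = refl
Rule-unique (L∨ _ _) (L∨ _ _) = refl
Rule-unique (R∨ _ _) (R∨ _ _) = refl
Rule-unique (L→ _ _) (L→ _ _) = refl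
Rule-unique (R→ _ _) (R→ _ _) = refl

Rule⇒G3p : Rule s χ es → ∀ U → G3p (map (_· U) es) (⟨ s ∣ χ ⟩ · U)
Rule⇒G3p (L∧ φ ψ) (Γ , Δ) = L∧ Γ Δ φ ψ
Rule⇒G3p (R∧ φ ψ) (Γ , Δ) = R∧ Γ Δ φ ψ
Rule⇒G3p (L∨ φ ψ) (Γ , Δ) = L∨ Γ Δ φ ψ
Rule⇒G3p (R∨ φ ψ) (Γ , Δ) = R∨ Γ Δ φ ψ
Rule⇒G3p (L→ φ ψ) (Γ , Δ) = L→ Γ Δ φ ψ
Rule⇒G3p (R→ φ ψ) (Γ , Δ) = R→ Γ Δ φ ψ

G3p⇒Axiom : G3p [] T → Axiom T
G3p⇒Axiom (ax Γ Δ p) = init p (here refl) (here refl)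
G3p⇒Axiom (ax⊥ Γ Δ) = ⊥L (here refl)

Axiom⇒G3pInst : Axiom T → G3pInst [] T
Axiom⇒G3pInst (init p pa ps) with Γ , a ← ∈⇒↭∷ pa | Δ , s ← ∈⇒↭∷ ps = _ , ax Γ Δ p , a , s
Axiom⇒G3pInst (⊥L ⊥a) with Γ , a ← ∈⇒↭∷ ⊥a = _ , ax⊥ Γ _ , a , ↭-refl

data G3pView : List Sequent → Sequent → Set where
  axiom : Axiom T → G3pView [] T
  rule  : ∀ U → Rule s χ es → G3pView (map (_· U) es) (⟨ s ∣ χ ⟩ · U)

g3pView : G3p ps T → G3pView ps T
g3pView g@(ax _ _ _) = axiom (G3p⇒Axiom g)
g3pView g@(ax⊥ _ _) = axiom (G3p⇒Axiom g)
g3pView (L∧ Γ Δ φ ψ) = rule (Γ , Δ) (L∧ φ ψ)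
g3pView (R∧ Γ Δ φ ψ) = rule (Γ , Δ) (R∧ φ ψ)
g3pView (L∨ Γ Δ φ ψ) = rule (Γ , Δ) (L∨ φ ψ)
g3pView (R∨ Γ Δ φ ψ) = rule (Γ , Δ) (R∨ φ ψ)
g3pView (L→ Γ Δ φ ψ) = rule (Γ , Δ) (L→ φ ψ)
g3pView (R→ Γ Δ φ ψ) = rule (Γ , Δ) (R→ φ ψ)

module _ (Core : List Sequent → Sequent → Set) where

  BoxInst-resp-≈ : T ≈ T' → BoxInst Core ps T → BoxInst Core ps T'
  BoxInst-resp-≈ T≈T' (S , C , c , T≈) = S , C , c , ≈-trans (≈-sym T≈T') T≈

  BoxInst-weaken : ∀ S' → BoxInst Core ps T → BoxInst Core ps (S' · T)
  BoxInst-weaken S' (S , C , c , T≈) =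
    S , S' · C , c , ≈-trans (∙-congˡ T≈) (≈-sym (assoc S' C (□ₛ S)))

  BoxInst-⟨⟩⁻ : ∀ s → (∀ ψ → χ ≢ □' ψ) → BoxInst Core ps (⟨ s ∣ χ ⟩ · U) → BoxInst Core ps U
  BoxInst-⟨⟩⁻ s χ≢□ (S , C , c , T≈) with boxSplit s T≈
  ... | inContext C' U≈ = S , C' , c , U≈
  ... | inBoxed _ _ _ = ⊥-elim (χ≢□ _ refl)

data ContractedInst (R : BoxRule) (ps : List Sequent) (T : Sequent) : Set where
  unchanged  : BoxRule.Inst R ps T → ContractedInst R ps T
  contracted : ∀ qs → Pointwise (λ P q → P ≈ proj₁ q · proj₂ q · proj₂ q) ps qs →
               BoxRule.Inst R (map (λ q → proj₁ q · proj₂ q) qs) T → ContractedInst R ps T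

BoxInst-contract : ∀ R s → BoxRule.Inst R ps (⟨ s ∣ φ ⟩ · (⟨ s ∣ φ ⟩ · U)) →
                   ContractedInst R ps (⟨ s ∣ φ ⟩ · U)
BoxInst-contract R s (S , C , c , T≈) with contractionBoxSplit s T≈
... | inContext C' U≈ = unchanged (S , C' , c , U≈)
... | inBoxed S₀ S₀' S≈ U≈
  with qs , pw , inst ← BoxRule.contr R _ C S₀ S₀' (S , C , c , ∙-congˡ (□ₛ-cong (≈-sym S≈))) =
  contracted qs pw (BoxInst-resp-≈ (BoxRule.Core R) (≈-sym U≈) inst)

module _ {I : Set} (ℛ : I → BoxRule) where

  Core : I → List Sequent → Sequent → Set
  Core i = BoxRule.Core (ℛ i)

  Inst : I → List Sequent → Sequent → Set
  Inst i = BoxInst (Core i)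

  data Der : ℕ → Sequent → Set where
    axiom   : Axiom T → Der d T
    box₀    : ∀ i → Inst i [] T → Der d T
    box     : ∀ i → Inst i ps T → All (Der d) ps → Der (suc d) T
    logical : ∀ U → Rule s χ es → T ≈ ⟨ s ∣ χ ⟩ · U → All (λ e → Der d (e · U)) es →
              Der (suc d) T

  -- Derivations are transported along _≈_ before recursive calls, so all recursions
  -- below terminate because the depth index decreases, not by structural descent.
  Der-resp-≈ : T ≈ T' → Der d T → Der d T'
  Der-resp-≈ T≈T' (axiom a) = axiom (Axiom-mono (≈⇒⊆ₛ T≈T') a)
  Der-resp-≈ T≈T' (box₀ i inst) = box₀ i (BoxInst-resp-≈ (Core i) T≈T' inst)
  Der-resp-≈ T≈T' (box i inst ds) = box i (BoxInst-resp-≈ (Core i) T≈T' inst) ds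
  Der-resp-≈ T≈T' (logical U r T≈ ds) = logical U r (≈-trans (≈-sym T≈T') T≈) ds

  Der-mono : Der d T → Der (suc d) T
  Der-mono (axiom a) = axiom a
  Der-mono (box₀ i inst) = box₀ i inst
  Der-mono (box i inst ds) = box i inst (All.map Der-mono ds)
  Der-mono (logical U r T≈ ds) = logical U r T≈ (All.map Der-mono ds)

  weaken : ∀ S' → Der d T → Der d (S' · T)
  weaken {T = T} S' (axiom a) = axiom (Axiom-mono (T⊆ₛS·T S' T) a)
  weaken S' (box₀ i inst) = box₀ i (BoxInst-weaken (Core i) S' inst)
  weaken S' (box i inst ds) = box i (BoxInst-weaken (Core i) S' inst) ds
  weaken S' (logical {s = s} {χ} U r T≈ ds) =
    logical (S' · U) r (≈-trans (∙-congˡ T≈) (x∙yz≈y∙xz S' ⟨ s ∣ χ ⟩ U))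
      (All.map (λ {e} D → Der-resp-≈ (x∙yz≈y∙xz S' e U) (weaken S' D)) ds)

  invert : ∀ {e} → Rule s χ es → e ∈ es → Der d (⟨ s ∣ χ ⟩ · U) → Der d (e · U)
  invert {s = s} {U = U} {e} r _ (axiom a) =
    axiom (Axiom-mono (T⊆ₛS·T e U)
      (Axiom-⟨⟩⁻ s (λ p → atom≢principal {p = p} r) (⊥≢principal r) a))
  invert {s = s} {e = e} r _ (box₀ i inst) =
    box₀ i (BoxInst-weaken (Core i) e (BoxInst-⟨⟩⁻ (Core i) s (λ _ → principal≢□ r) inst))
  invert {s = s} {e = e} r _ (box i inst ds) =
    box i (BoxInst-weaken (Core i) e (BoxInst-⟨⟩⁻ (Core i) s (λ _ → principal≢□ r) inst)) ds
  invert {s = s} {χ} {e = e} r e∈es (logical {s = s'} {χ'} W r' T≈ ds)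
    with compareInsertions s s' T≈
  ... | same U≈W with refl ← Rule-unique r r' =
    Der-mono (Der-resp-≈ (∙-congˡ (≈-sym U≈W)) (All.lookup ds e∈es))
  ... | distinct V W≈ U≈ =
    logical (e · V) r' (≈-trans (∙-congˡ U≈) (x∙yz≈y∙xz e ⟨ s' ∣ χ' ⟩ V))
      (All.map (λ {e'} D → Der-resp-≈ (x∙yz≈y∙xz e e' V)
                  (invert r e∈es (Der-resp-≈ (≈-trans (∙-congˡ W≈) (x∙yz≈y∙xz e' ⟨ s ∣ χ ⟩ V)) D)))
               ds)

  mutual
    contract : ∀ s φ U → Der d (⟨ s ∣ φ ⟩ · (⟨ s ∣ φ ⟩ · U)) → Der d (⟨ s ∣ φ ⟩ · U)
    contract s φ U (axiom a) = axiom (Axiom-mono (S·S·T⊆ₛS·T ⟨ s ∣ φ ⟩ U) a)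
    contract s φ U (box₀ i inst) with BoxInst-contract (ℛ i) s inst
    ... | unchanged inst' = box₀ i inst'
    ... | contracted [] [] inst' = box₀ i inst'
    contract s φ U (box i inst ds) with BoxInst-contract (ℛ i) s inst
    ... | unchanged inst' = box i inst' ds
    ... | contracted qs pw inst' = box i inst' (contractPremisses pw ds)
    contract s φ U (logical {s = s'} {χ} W r T≈ ds) with compareInsertions s s' T≈
    ... | same φU≈W = contractPrincipal r (≈-sym φU≈W) ds
    ... | distinct W₁ W≈ φU≈ with compareInsertions s s' φU≈
    ...   | same U≈W₁ = contractPrincipal r (≈-trans W≈ (∙-congˡ (≈-sym U≈W₁))) ds
    ...   | distinct V W₁≈ U≈ =
      logical (P · V) r (≈-trans (∙-congˡ U≈) (x∙yz≈y∙xz P ⟨ s' ∣ χ ⟩ V))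
        (All.map (λ {e} D → Der-resp-≈ (x∙yz≈y∙xz P e V)
                    (contract s φ (e · V) (Der-resp-≈ (e·W≈ e) D)))
                 ds)
      where
      P : Sequent
      P = ⟨ s ∣ φ ⟩

      e·W≈ : ∀ e → e · W ≈ P · (P · (e · V))
      e·W≈ e = ≈-trans (∙-congˡ (≈-trans W≈ (∙-congˡ W₁≈)))
                       (solve 3 (λ e P V → e ⊕ (P ⊕ (P ⊕ V)) ⊜ P ⊕ (P ⊕ (e ⊕ V))) ≈-refl e P V)

    contractPrincipal : Rule s φ es → W ≈ ⟨ s ∣ φ ⟩ · U → All (λ e → Der d (e · W)) es →
                        Der (suc d) (⟨ s ∣ φ ⟩ · U)
    contractPrincipal {s = s} {φ} {U = U} r W≈ ds =
      logical U r ≈-refl (All.tabulate λ {e} e∈es →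
        contractAll e U (invert r e∈es
          (Der-resp-≈ (≈-trans (∙-congˡ W≈) (x∙yz≈y∙xz e ⟨ s ∣ φ ⟩ U)) (All.lookup ds e∈es))))

    contractPremisses : ∀ {qs} → Pointwise (λ P q → P ≈ proj₁ q · proj₂ q · proj₂ q) ps qs →
                        All (Der d) ps → All (Der d) (map (λ q → proj₁ q · proj₂ q) qs)
    contractPremisses [] [] = []
    contractPremisses (_∷_ {y = S , S'} P≈ pw) (D ∷ ds) =
      Der-resp-≈ (comm S' S) (contractAll S' S (Der-resp-≈ (≈-trans P≈ regroup) D))
      ∷ contractPremisses pw ds
      where
      regroup : S · S' · S' ≈ S' · (S' · S)
      regroup = solve 2 (λ S S' → (S ⊕ S') ⊕ S' ⊜ S' ⊕ (S' ⊕ S)) ≈-refl S S'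

    contractAll : ∀ S U → Der d (S · (S · U)) → Der d (S · U)
    contractAll ([] , []) U D = D
    contractAll ([] , φ ∷ Δ) U D = contractAll-⟨⟩· right φ ([] , Δ) U D
    contractAll (φ ∷ Γ , Δ) U D = contractAll-⟨⟩· left φ (Γ , Δ) U D

    contractAll-⟨⟩· : ∀ s φ S U → Der d (⟨ s ∣ φ ⟩ · S · (⟨ s ∣ φ ⟩ · S · U)) →
                      Der d (⟨ s ∣ φ ⟩ · S · U)
    contractAll-⟨⟩· s φ S U D =
      Der-resp-≈ (solve 3 (λ P S U → S ⊕ (P ⊕ U) ⊜ (P ⊕ S) ⊕ U) ≈-refl P S U)
        (contractAll S (P · U)
          (Der-resp-≈ (solve 3 (λ P S U → P ⊕ (S ⊕ (S ⊕ U)) ⊜ S ⊕ (S ⊕ (P ⊕ U))) ≈-refl P S U)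
            (contract s φ (S · (S · U))
              (Der-resp-≈ (solve 3 (λ P S U → (P ⊕ S) ⊕ ((P ⊕ S) ⊕ U) ⊜ P ⊕ (P ⊕ (S ⊕ (S ⊕ U))))
                                   ≈-refl P S U)
                D))))
      where
      P : Sequent
      P = ⟨ s ∣ φ ⟩

  toDer : ⊢[ ℛ ] d , T → Der d T
  toDer (leaf (inj₁ (_ , g , T≈))) = axiom (Axiom-mono (≈⇒⊆ₛ (≈-sym T≈)) (G3p⇒Axiom g))
  toDer (leaf (inj₂ (i , inst))) = box₀ i inst
  toDer (node (inj₁ (_ , g , T≈)) ds) with g3pView g
  ... | axiom a = axiom (Axiom-mono (≈⇒⊆ₛ (≈-sym T≈)) a)
  ... | rule U r = logical U r T≈ (Allₚ.map⁻ (All.map toDer ds))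
  toDer (node (inj₂ (i , inst)) ds) = box i inst (All.map toDer ds)

  fromDer : Der d T → ⊢[ ℛ ] d , T
  fromDer (axiom a) = leaf (inj₁ (Axiom⇒G3pInst a))
  fromDer (box₀ i inst) = leaf (inj₂ (i , inst))
  fromDer (box i inst ds) = node (inj₂ (i , inst)) (All.map fromDer ds)
  fromDer (logical U r T≈ ds) =
    node (inj₁ (_ , Rule⇒G3p r U , T≈)) (Allₚ.map⁺ (All.map fromDer ds))

  weakening : ∀ S' → ⊢[ ℛ ] d , S → ⊢[ ℛ ] d , (S' · S)
  weakening S' D = fromDer (weaken S' (toDer D))

  contraction : ∀ S' S → ⊢[ ℛ ] d , (S' · S' · S) → ⊢[ ℛ ] d , (S' · S)
  contraction S' S D = fromDer (contractAll S' S (Der-resp-≈ (assoc S' S' S) (toDer D)))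

lemma2p4 : (I : Set) (R : I → BoxRule) →
    ((S S' : Sequent) (d : ℕ) → ⊢[ R ] d , S → ⊢[ R ] d , (S' · S)) ×
    ((S S' : Sequent) (d : ℕ) → ⊢[ R ] d , (S' · S' · S) → ⊢[ R ] d , (S' · S))
lemma2p4 I R = (λ S S' d → weakening R S') , (λ S S' d → contraction R S' S)
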